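{- Assume the following conjecture (Spiro–Verstraëte): for all integers $l\ge 3$ and $r\ge 2$, with $k=\lfloor l/2\rfloor$, the maximum number of hyperedges of an $n$-vertex $r$-uniform hypergraph of girth at least $l+1$ is $n^{1+1/k-o(1)}$. Then for all integers $k\ge 1$, $f\ge 1$, $r\ge 2$, there exist infinite families of undirected unweighted $n$-vertex $r$-uniform hypergraphs $H$ with $\Omega\!\left(f^{1-1/r-1/(rk)}\,n^{1+1/k-o(1)}\right)$ hyperedges such that every $f$-edge-fault-tolerant $(2k-1)$-hyperspanner of $H$ must contain all hyperedges of $H$.
   Context: A hypergraph $H=(V,E)$ is $r$-uniform if every hyperedge has exactly $r$ vertices; unweighted means every hyperedge has weight $1$. A path between $u$ and $v$ is a sequence of vertices $u=x_0,\dots,x_\ell=v$ with hyperedges $h_1,\dots,h_\ell$ such that $x_{j-1},x_j\in h_j$; its length is the sum of the weights of $h_1,\dots,h_\ell$, and $\delta_H(u,v)$ is the minimum length of a $u$–$v$ path. A (Berge) cycle of length $\ell\ge 2$ consists of distinct vertices $v_1,\dots,v_\ell$ and distinct hyperedges $h_1,\dots,h_\ell$ with $v_i,v_{i+1}\in h_i$ (indices mod $\ell$); the girth is the minimum length of a cycle. For $F\subseteq E$, $H\setminus F$ has hyperedge set $E\setminus F$. A sub-hypergraph $S=(V,E')$, $E'\subseteq E$, is an $f$-edge-fault-tolerant $t$-hyperspanner of $H$ if for all $u,v\in V$ and all $F\subseteq E$ with $|F|\le f$, $\delta_{S\setminus F}(u,v)\le t\cdot\delta_{H\setminus F}(u,v)$.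 -}

module Defs where

open import Data.Nat using (ℕ; zero; suc; _+_; _*_; _∸_; _^_; _≤_; _<_; ⌊_/2⌋)
open import Data.Nat.DivMod using (_%_; m%n<n)
open import Data.Fin using (Fin; toℕ; fromℕ<)
open import Data.Fin.Subset using (Subset; _∈_; ∣_∣; ∁; _∩_)
open import Data.Product using (Σ; ∃; _×_)
open import Relation.Binary.PropositionalEquality using (_≡_)
open import Relation.Nullary using (¬_)
open import Function.Definitions using (Injective)

record Hypergraph (n : ℕ) : Set where
  constructor hypergraph
  field
    m    : ℕ
    edge : Fin m → Subset n
open Hypergraph public

Uniform : ∀ {n} → ℕ → Hypergraph n → Set
Uniform r H = ∀ e → ∣ edge H e ∣ ≡ r

Simple : ∀ {n} → Hypergraph n → Set
Simple H = Injective _≡_ _≡_ (edge H)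

data Path {n} (H : Hypergraph n) (A : Subset (m H)) : Fin n → Fin n → ℕ → Set where
  nil  : ∀ {u} → Path H A u u 0
  step : ∀ {u w v ℓ} (h : Fin (m H)) → h ∈ A → u ∈ edge H h → w ∈ edge H h →
         Path H A w v ℓ → Path H A u v (suc ℓ)

DistLe : ∀ {n} (H : Hypergraph n) → Subset (m H) → Fin n → Fin n → ℕ → Set
DistLe H A u v d = ∃ λ ℓ → ℓ ≤ d × Path H A u v ℓ

-- S (a set of hyperedges of H) is an f-edge-fault-tolerant t-hyperspanner of H:
-- for all F with |F| ≤ f and all u v, δ_{S∖F}(u,v) ≤ t · δ_{H∖F}(u,v)
-- (i.e. every (H∖F)-path of length ℓ yields an (S∖F)-path of length ≤ t·ℓ).
FTSpanner : ∀ {n} → ℕ → ℕ → (H : Hypergraph n) → Subset (m H) → Set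
FTSpanner f t H S =
  ∀ (F : Subset (m H)) → ∣ F ∣ ≤ f → ∀ u v ℓ →
  Path H (∁ F) u v ℓ → DistLe H (S ∩ ∁ F) u v (t * ℓ)

next : ∀ {ℓ} → Fin ℓ → Fin ℓ
next {suc ℓ} i = fromℕ< (m%n<n (suc (toℕ i)) (suc ℓ))

record Cycle {n} (H : Hypergraph n) (ℓ : ℕ) : Set where
  field
    vs    : Fin ℓ → Fin n
    hs    : Fin ℓ → Fin (m H)
    vsInj : Injective _≡_ _≡_ vs
    hsInj : Injective _≡_ _≡_ hs
    inL   : ∀ i → vs i ∈ edge H (hs i)
    inR   : ∀ i → vs (next i) ∈ edge H (hs i)

GirthAtLeast : ∀ {n} → ℕ → Hypergraph n → Set
GirthAtLeast g H = ∀ ℓ → 2 ≤ ℓ → ℓ < g → ¬ Cycle H ℓ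

IsMaxEdges : ℕ → ℕ → ℕ → ℕ → Set
IsMaxEdges n r l M =
  (Σ (Hypergraph n) λ H → Simple H × Uniform r H × GirthAtLeast (suc l) H × m H ≡ M) ×
  (∀ (H : Hypergraph n) → Simple H → Uniform r H → GirthAtLeast (suc l) H → m H ≤ M)

-- Spiro–Verstraëte conjecture: ex = n^{1+1/k-o(1)}, k = ⌊l/2⌋, i.e. for every ε = 1/q,
-- for all large n:  n^{1+1/k-1/q} ≤ ex ≤ n^{1+1/k+1/q}  (raised to the power q·k).
SVConjecture : Set
SVConjecture =
  ∀ l r → 3 ≤ l → 2 ≤ r → ∀ q → 1 ≤ q →
  ∃ λ N → ∀ n → N ≤ n → ∀ M → IsMaxEdges n r l M →
    let k = ⌊ l /2⌋ in
    (n ^ (q * k + q ∸ k) ≤ M ^ (q * k)) × (M ^ (q * k) ≤ n ^ (q * k + q + k))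

-- An infinite family (indexed by i, with unbounded vertex counts ns i) of simple r-uniform
-- hypergraphs such that every f-FT (2k-1)-hyperspanner contains all hyperedges, and
-- |E(H_i)| ≥ (1/C) f^{1-1/r-1/(rk)} n_i^{1+1/k-o(1)}: for every ε = 1/q, for all large n_i,
-- f^{(rk-k-1)q} · n_i^{(qk+q-k)r} ≤ (C·|E(H_i)|)^{rkq}.
LowerBoundFamily : ℕ → ℕ → ℕ → ℕ → Set
LowerBoundFamily k f r C =
  Σ (ℕ → ℕ) λ ns → Σ ((i : ℕ) → Hypergraph (ns i)) λ Hs →
    (∀ N → ∃ λ i → N ≤ ns i) ×
    (∀ i → Simple (Hs i) × Uniform r (Hs i) ×
           (∀ (S : Subset (m (Hs i))) → FTSpanner f (2 * k ∸ 1) (Hs i) S →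
              ∀ e → e ∈ S)) ×
    (∀ q → 1 ≤ q → ∃ λ N → ∀ i → N ≤ ns i →
       f ^ ((r * k ∸ k ∸ 1) * q) * ns i ^ ((q * k + q ∸ k) * r)
         ≤ (C * m (Hs i)) ^ (r * k * q))

{-# OPTIONS --safe #-}

-- Take an extremal n-vertex r-uniform hypergraph G of girth at least 2k + 2 (a maximum exists
-- because the candidates can be enumerated) and blow it up: every vertex becomes b = ⌊ f^(1/r) ⌋
-- clones, and every hyperedge h becomes the b^r hyperedges picking one clone of each vertex of h.
-- If an f-fault-tolerant (2k − 1)-spanner S missed a copy e of h, failing the at most b^r ≤ f
-- copies of h kept by S would leave two clones in e joined in S by a path of length ≤ 2k − 1
-- avoiding all copies of h. Its projection is a path in G − h between two vertices of h, closing
-- a cycle of length ≤ 2k below the girth. The blow-up has n b vertices and |E(G)| b^r hyperedges,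
-- so the conjectured lower bound on |E(G)| yields the density.

module Submission where

open import Defs
open import Data.Bool using () renaming (_≟_ to _≟ᵇ_)
open import Data.Empty using (⊥-elim)
open import Data.Fin using (Fin; zero; suc; toℕ; fromℕ; inject₁; combine; remQuot; quotient; remainder)
open import Data.Fin.Properties using (any?; all?; ¬Fin0; combine-injective; injective⇒≤; toℕ-injective;
  toℕ-fromℕ<; toℕ-inject₁; toℕ-fromℕ; toℕ<n; combine-remQuot; remQuot-combine; suc-injective)
  renaming (_≟_ to _≟ᶠ_)
open import Data.Fin.Subset using (Subset; Side; _∈_; _∉_; ∣_∣; ⁅_⁆; _∩_; ∁; inside; outside; ⊥; ⊤)
open import Data.Fin.Subset.Properties using (_∈?_; anySubset?; ∉⊥; x∈⁅x⁆; x∈⁅y⁆⇒x≡y; ∣⊥∣≡0; ∣⊤∣≡n;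
  ∣⁅x⁆∣≡1; p⊆q⇒∣p∣≤∣q∣; p∩q⊆p; x∈p∩q⁺; x∈p∩q⁻; x∈∁p⇒x∉p; x∉p⇒x∈∁p)
open import Data.Nat using (ℕ; zero; suc; _+_; _*_; _∸_; _^_; _%_; _≤_; _<_; z≤n; s≤s; _≤?_; _≟_; ⌊_/2⌋;
  NonZero; >-nonZero; >-nonZero⁻¹)
open import Data.Nat.DivMod using (m<n⇒m%n≡m; n%n≡0)
open import Data.Nat.Properties using (allUpTo?; ≤-refl; ≤-reflexive; ≤-trans; ≤-<-trans; ≤-pred; <⇒≤;
  <-irrefl; ≮⇒≥; ≰⇒>; m≤n⇒m<n∨m≡n; m≤n⇒m≤1+n; n≤1+n; m≤m*n; m≤n*m; m∸n≤m; m∸n+n≡m; ∸-+-assoc;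
  +-comm; +-suc; +-identityʳ; +-monoˡ-≤; +-monoʳ-≤; *-comm; *-assoc; *-identityˡ; *-identityʳ;
  *-distribˡ-+; *-distribʳ-+; *-monoˡ-≤; *-monoʳ-≤; *-mono-≤; *-cancelʳ-≤; *-commutativeSemigroup;
  ^-zeroˡ; ^-*-assoc; ^-distribˡ-+-*; ^-monoˡ-≤; ^-monoʳ-≤; ^-monoˡ-<; m^n>0; module ≤-Reasoning)
open import Algebra.Properties.CommutativeSemigroup *-commutativeSemigroup using (interchange)
open import Data.Product using (Σ; ∃; ∃₂; _×_; _,_; proj₁; proj₂; <_,_>; uncurry)
open import Data.Sum using (_⊎_; inj₁; inj₂)
open import Data.Vec using (Vec; []; _∷_; _++_; _∷ʳ_; concat; lookup; map; replicate; head; tail;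
  here; there)
import Data.Vec.Functional as Vector
open import Data.Vec.Properties using (≡-dec; lookup-concat; lookup-map; lookup-replicate; ++-injective;
  ∷-injective; []=⇒lookup; lookup⇒[]=)
open import Data.Vec.Relation.Unary.All using (All; []; _∷_)
import Data.Vec.Relation.Unary.All as All
open import Data.Vec.Relation.Unary.Any as Any using (Any; here; there)
open import Data.Vec.Relation.Unary.Unique.Propositional using (Unique; []; _∷_)
open import Data.Vec.Relation.Unary.Unique.Propositional.Properties using (lookup-injective)
open import Function using (_∘_; _⇔_; mk⇔)
open import Function.Definitions using (Injective)
open import Relation.Binary.Definitions using (DecidableEquality; _Respects_)
open import Relation.Binary.PropositionalEquality using (_≡_; _≢_; refl; sym; trans; cong; cong₂; subst;
  subst₂; subst-injective; _≗_; module ≡-Reasoning)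
open import Relation.Nullary using (Dec; yes; no; ¬_; contradiction)
open import Relation.Nullary.Decidable using (map′; _×-dec_; _→-dec_; ¬?)
import Relation.Nullary.Decidable as Dec

private variable
  A B : Set
  b k n ℓ : ℕ

-- Extremal hypergraphs exist

Searchable : Set → Set₁
Searchable A = ∀ {P : A → Set} → (∀ a → Dec (P a)) → Dec (∃ P)

search-× : Searchable A → Searchable B → Searchable (A × B)
search-× searchA searchB P? =
  map′ (λ (a , b , p) → (a , b) , p) (λ ((a , b) , p) → a , b , p)
       (searchA λ a → searchB λ b → P? (a , b))

search-→ : Searchable A → ∀ k {P : (Fin k → A) → Set} → P Respects _≗_ →
           (∀ f → Dec (P f)) → Dec (∃ P)
search-→ searchA zero resp P? = map′ (empty ,_) (λ (f , p) → resp (λ ()) p) (P? empty)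
  where
  empty : Fin 0 → A
  empty ()
search-→ searchA (suc k) resp P? =
  map′ (λ (x , f , p) → x Vector.∷ f , p)
       (λ (f , p) → Vector.head f , Vector.tail f , resp head∷tail p)
       (searchA λ x → search-→ searchA k (resp ∘ ∷-cong) (P? ∘ (x Vector.∷_)))
  where
  head∷tail : ∀ {f : Fin (suc k) → A} → f ≗ Vector.head f Vector.∷ Vector.tail f
  head∷tail zero    = refl
  head∷tail (suc i) = refl
  ∷-cong : ∀ {x} {f g : Fin k → A} → f ≗ g → x Vector.∷ f ≗ x Vector.∷ g
  ∷-cong f≗g zero    = refl
  ∷-cong f≗g (suc i) = f≗g i

injective? : DecidableEquality B → (f : Fin k → B) → Dec (Injective _≡_ _≡_ f)
injective? _≟_ f = map′ (λ inj {i} {j} → inj i j) (λ inj i j → inj)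
  (all? λ i → all? λ j → f i ≟ f j →-dec i ≟ᶠ j)

injective-resp-≗ : Injective {A = Fin k} {B = B} _≡_ _≡_ Respects _≗_
injective-resp-≗ f≗g inj {i} {j} gi≡gj = inj (trans (f≗g i) (trans gi≡gj (sym (f≗g j))))

-- A cycle as one function to (vertex, hyperedge) pairs, so that a single search finds it.
IsCycle : ∀ {m} → (Fin m → Subset n) → (Fin ℓ → Fin n × Fin m) → Set
IsCycle E w = Injective _≡_ _≡_ (proj₁ ∘ w) × Injective _≡_ _≡_ (proj₂ ∘ w) ×
              (∀ i → proj₁ (w i) ∈ E (proj₂ (w i))) × (∀ i → proj₁ (w (next i)) ∈ E (proj₂ (w i)))

∃IsCycle⇔Cycle : (H : Hypergraph n) → ∃ (IsCycle {ℓ = ℓ} (edge H)) ⇔ Cycle H ℓ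
∃IsCycle⇔Cycle H = mk⇔
  (λ (w , vsInj , hsInj , inL , inR) → record
    { vs = proj₁ ∘ w ; hs = proj₂ ∘ w ; vsInj = vsInj ; hsInj = hsInj ; inL = inL ; inR = inR })
  (λ c → let open Cycle c in < vs , hs > , (λ {i j} → vsInj) , (λ {i j} → hsInj) , inL , inR)

IsCycle-resp : ∀ {m} {E : Fin m → Subset n} → IsCycle {ℓ = ℓ} E Respects _≗_
IsCycle-resp {E = E} w≗w′ (vsInj , hsInj , inL , inR) =
  injective-resp-≗ (cong proj₁ ∘ w≗w′) vsInj , injective-resp-≗ (cong proj₂ ∘ w≗w′) hsInj ,
  (λ i → subst₂ (λ x y → proj₁ x ∈ E (proj₂ y)) (w≗w′ i) (w≗w′ i) (inL i)) ,
  (λ i → subst₂ (λ x y → proj₁ x ∈ E (proj₂ y)) (w≗w′ (next i)) (w≗w′ i) (inR i))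

cycle? : (H : Hypergraph n) → ∀ ℓ → Dec (Cycle H ℓ)
cycle? H ℓ = Dec.map (∃IsCycle⇔Cycle H)
  (search-→ (search-× any? any?) ℓ (IsCycle-resp {E = edge H}) isCycle?)
  where
  isCycle? : ∀ w → Dec (IsCycle (edge H) w)
  isCycle? w = injective? _≟ᶠ_ (proj₁ ∘ w) ×-dec injective? _≟ᶠ_ (proj₂ ∘ w) ×-dec
               all? (λ i → proj₁ (w i) ∈? edge H (proj₂ (w i))) ×-dec
               all? (λ i → proj₁ (w (next i)) ∈? edge H (proj₂ (w i)))

girthAtLeast? : ∀ g (H : Hypergraph n) → Dec (GirthAtLeast g H)
girthAtLeast? g H =
  map′ (λ acyclic ℓ 2≤ℓ ℓ<g → acyclic ℓ<g 2≤ℓ) (λ girth {ℓ} ℓ<g 2≤ℓ → girth ℓ 2≤ℓ ℓ<g)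
       (allUpTo? (λ ℓ → 2 ≤? ℓ →-dec ¬? (cycle? H ℓ)) g)

cycle-resp-≗ : ∀ {E E′ : Fin k → Subset n} → E ≗ E′ → Cycle (hypergraph k E) ℓ → Cycle (hypergraph k E′) ℓ
cycle-resp-≗ E≗E′ c = record
  { vs = vs ; hs = hs ; vsInj = vsInj ; hsInj = hsInj
  ; inL = λ i → subst (_ ∈_) (E≗E′ _) (inL i) ; inR = λ i → subst (_ ∈_) (E≗E′ _) (inR i) }
  where open Cycle c

Attained : ℕ → ℕ → ℕ → ℕ → Set
Attained n r l M = Σ (Hypergraph n) λ H → Simple H × Uniform r H × GirthAtLeast (suc l) H × m H ≡ M

attained? : ∀ n r l M → Dec (Attained n r l M)
attained? n r l M = map′ toAttained fromAttained (search-→ anySubset? M resp (good? ∘ hypergraph M))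
  where
  Good : Hypergraph n → Set
  Good H = Simple H × Uniform r H × GirthAtLeast (suc l) H
  good? : ∀ H → Dec (Good H)
  good? H = injective? (≡-dec _≟ᵇ_) (edge H) ×-dec all? (λ e → ∣ edge H e ∣ ≟ r) ×-dec
            girthAtLeast? (suc l) H
  resp : (Good ∘ hypergraph M) Respects _≗_
  resp E≗E′ (simple , uniform , girth) =
    injective-resp-≗ E≗E′ simple ,
    (λ e → trans (cong ∣_∣ (sym (E≗E′ e))) (uniform e)) ,
    (λ ℓ 2≤ℓ ℓ<g → girth ℓ 2≤ℓ ℓ<g ∘ cycle-resp-≗ (sym ∘ E≗E′))
  toAttained : ∃ (Good ∘ hypergraph M) → Attained n r l M
  toAttained (E , simple , uniform , girth) = hypergraph M E , simple , uniform , girth , refl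
  fromAttained : Attained n r l M → ∃ (Good ∘ hypergraph M)
  fromAttained (hypergraph _ E , simple , uniform , girth , refl) = E , simple , uniform , girth

side : Side → Fin 2
side outside = zero
side inside  = suc zero

side-injective : Injective _≡_ _≡_ side
side-injective {outside} {outside} _ = refl
side-injective {inside}  {inside}  _ = refl

encode : Subset n → Fin (2 ^ n)
encode []      = zero
encode (s ∷ p) = combine (side s) (encode p)

encode-injective : Injective _≡_ _≡_ (encode {n})
encode-injective {x = []}    {[]}    _  = refl
encode-injective {x = s ∷ p} {t ∷ q} eq =
  let s≡t , p≡q = combine-injective (side s) (encode p) (side t) (encode q) eq
  in cong₂ _∷_ (side-injective s≡t) (encode-injective p≡q)

simple⇒m≤2^n : (H : Hypergraph n) → Simple H → m H ≤ 2 ^ n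
simple⇒m≤2^n H simple = injective⇒≤ (simple ∘ encode-injective)

largest : ∀ {P : ℕ → Set} → (∀ k → Dec (P k)) → P 0 → ∀ K → ∃ λ M → P M × (∀ k → k ≤ K → P k → k ≤ M)
largest P? P0 zero = 0 , P0 , λ { k z≤n _ → z≤n }
largest {P} P? P0 (suc K) with P? (suc K) | largest P? P0 K
... | yes P[1+K] | _ = suc K , P[1+K] , λ _ k≤1+K _ → k≤1+K
... | no ¬P[1+K] | M , PM , max = M , PM , λ k k≤1+K Pk → max k (k≤K k≤1+K Pk) Pk
  where
  k≤K : ∀ {k} → k ≤ suc K → P k → k ≤ K
  k≤K k≤1+K Pk with m≤n⇒m<n∨m≡n k≤1+K
  ... | inj₁ k<1+K = ≤-pred k<1+K
  ... | inj₂ refl  = contradiction Pk ¬P[1+K]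

empty-attained : ∀ n r l → Attained n r l 0
empty-attained n r l = hypergraph 0 (λ ()) , (λ { {()} }) , (λ ()) , acyclic , refl
  where
  acyclic : GirthAtLeast (suc l) (hypergraph 0 (λ ()))
  acyclic (suc _) _ _ c = ¬Fin0 (Cycle.hs c zero)

maxEdges-exists : ∀ n r l → ∃ (IsMaxEdges n r l)
maxEdges-exists n r l with largest (attained? n r l) (empty-attained n r l) (2 ^ n)
... | M , attained , max = M , attained , λ H simple uniform girth →
  max (m H) (simple⇒m≤2^n H simple) (H , simple , uniform , girth , refl)

-- Short detours around a hyperedge close short cycles

¬Any⇒All¬ : ∀ {P : A → Set} (xs : Vec A k) → ¬ Any P xs → All (¬_ ∘ P) xs
¬Any⇒All¬ []       _    = []
¬Any⇒All¬ (x ∷ xs) ¬any = ¬any ∘ here ∷ ¬Any⇒All¬ xs (¬any ∘ there)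

All-∷ʳ : ∀ {P : A → Set} {xs : Vec A k} {x} → All P xs → P x → All P (xs ∷ʳ x)
All-∷ʳ []         px = px ∷ []
All-∷ʳ (py ∷ pxs) px = py ∷ All-∷ʳ pxs px

Unique-∷ʳ : ∀ {xs : Vec A k} {x} → Unique xs → All (_≢ x) xs → Unique (xs ∷ʳ x)
Unique-∷ʳ []           []           = [] ∷ []
Unique-∷ʳ (y∉ys ∷ ys!) (y≢x ∷ ys≢x) = All-∷ʳ y∉ys y≢x ∷ Unique-∷ʳ ys! ys≢x

next-inject₁ : (i : Fin k) → next (inject₁ i) ≡ suc i
next-inject₁ {k} i = toℕ-injective (begin
  toℕ (next (inject₁ i))        ≡⟨ toℕ-fromℕ< _ ⟩
  suc (toℕ (inject₁ i)) % suc k ≡⟨ cong (λ j → suc j % suc k) (toℕ-inject₁ i) ⟩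
  suc (toℕ i) % suc k           ≡⟨ m<n⇒m%n≡m (s≤s (toℕ<n i)) ⟩
  suc (toℕ i)                   ∎)
  where open ≡-Reasoning

next-fromℕ : ∀ k → next (fromℕ k) ≡ zero
next-fromℕ k = toℕ-injective (begin
  toℕ (next (fromℕ k))        ≡⟨ toℕ-fromℕ< _ ⟩
  suc (toℕ (fromℕ k)) % suc k ≡⟨ cong (λ j → suc j % suc k) (toℕ-fromℕ k) ⟩
  suc k % suc k               ≡⟨ n%n≡0 (suc k) ⟩
  0                           ∎)
  where open ≡-Reasoning

fromℕ-or-inject₁ : (i : Fin (suc k)) → i ≡ fromℕ k ⊎ ∃ λ j → i ≡ inject₁ j
fromℕ-or-inject₁ {zero}  zero    = inj₁ refl
fromℕ-or-inject₁ {suc k} zero    = inj₂ (zero , refl)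
fromℕ-or-inject₁ {suc k} (suc i) with fromℕ-or-inject₁ i
... | inj₁ refl       = inj₁ refl
... | inj₂ (j , refl) = inj₂ (suc j , refl)

lookup-∷ʳ-fromℕ : (xs : Vec A k) (x : A) → lookup (xs ∷ʳ x) (fromℕ k) ≡ x
lookup-∷ʳ-fromℕ []       x = refl
lookup-∷ʳ-fromℕ (_ ∷ xs) x = lookup-∷ʳ-fromℕ xs x

lookup-∷ʳ-inject₁ : (xs : Vec A k) (x : A) (i : Fin k) → lookup (xs ∷ʳ x) (inject₁ i) ≡ lookup xs i
lookup-∷ʳ-inject₁ (_ ∷ xs) x zero    = refl
lookup-∷ʳ-inject₁ (_ ∷ xs) x (suc i) = lookup-∷ʳ-inject₁ xs x i

lookup-next : (xs : Vec A (suc k)) (i : Fin (suc k)) → lookup xs (next i) ≡ lookup (tail xs ∷ʳ head xs) i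
lookup-next {k = k} (x ∷ xs) i with fromℕ-or-inject₁ i
... | inj₁ refl = begin
  lookup (x ∷ xs) (next (fromℕ k)) ≡⟨ cong (lookup (x ∷ xs)) (next-fromℕ k) ⟩
  x                                ≡⟨ lookup-∷ʳ-fromℕ xs x ⟨
  lookup (xs ∷ʳ x) (fromℕ k)       ∎
  where open ≡-Reasoning
... | inj₂ (j , refl) = begin
  lookup (x ∷ xs) (next (inject₁ j)) ≡⟨ cong (lookup (x ∷ xs)) (next-inject₁ j) ⟩
  lookup xs j                        ≡⟨ lookup-∷ʳ-inject₁ xs x j ⟨
  lookup (xs ∷ʳ x) (inject₁ j)       ∎
  where open ≡-Reasoning

module _ {n} {G : Hypergraph n} where

  private variable
    u v w x y : Fin n
    E : Subset (m G)

  targets : Path G E u v ℓ → Vec (Fin n) ℓ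
  targets nil                      = []
  targets (step {w = w} _ _ _ _ p) = w ∷ targets p

  vertices : Path G E u v ℓ → Vec (Fin n) (suc ℓ)
  vertices {u = u} p = u ∷ targets p

  edges : Path G E u v ℓ → Vec (Fin (m G)) ℓ
  edges nil              = []
  edges (step h _ _ _ p) = h ∷ edges p

  edges-∈ : (p : Path G E u v ℓ) → All (_∈ E) (edges p)
  edges-∈ nil                 = []
  edges-∈ (step _ h∈E _ _ p) = h∈E ∷ edges-∈ p

  IsSimplePath : Path G E u v ℓ → Set
  IsSimplePath p = Unique (vertices p) × Unique (edges p)

  record SimplePathWithin (E : Subset (m G)) (u v : Fin n) (bound : ℕ) : Set where
    constructor simplePath
    field
      {length} : ℕ
      length≤  : length ≤ bound
      path     : Path G E u v length
      simple   : IsSimplePath path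

  relax : k ≤ ℓ → SimplePathWithin E u v k → SimplePathWithin E u v ℓ
  relax k≤ℓ (simplePath ≤k p simple) = simplePath (≤-trans ≤k k≤ℓ) p simple

  suffix-from : (p : Path G E w v ℓ) → IsSimplePath p → Any (u ≡_) (vertices p) →
                SimplePathWithin E u v ℓ
  suffix-from p simple (here refl) = simplePath ≤-refl p simple
  suffix-from (step _ _ _ _ p) (_ ∷ vs! , _ ∷ es!) (there u∈) =
    relax (n≤1+n _) (suffix-from p (vs! , es!) u∈)

  suffix-through : ∀ {h} (p : Path G E w v ℓ) → IsSimplePath p → All (u ≢_) (vertices p) →
                   Any (h ≡_) (edges p) → u ∈ edge G h → SimplePathWithin E u v ℓ
  suffix-through (step h h∈E _ t∈h p) (_ ∷ vs! , es!) (_ ∷ u∉) (here refl) u∈h =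
    simplePath ≤-refl (step h h∈E u∈h t∈h p) (u∉ ∷ vs! , es!)
  suffix-through (step _ _ _ _ p) (_ ∷ vs! , _ ∷ es!) (_ ∷ u∉) (there h∈) u∈h =
    relax (n≤1+n _) (suffix-through p (vs! , es!) u∉ h∈ u∈h)

  simplify : (p : Path G E u v ℓ) → SimplePathWithin E u v ℓ
  simplify nil = simplePath z≤n nil ([] ∷ [] , [])
  simplify {u = u} (step h h∈E u∈h w∈h p) with simplify p
  ... | simplePath ≤ℓ q (vs! , es!) with Any.any? (u ≟ᶠ_) (vertices q)
  ...   | yes u∈ = relax (m≤n⇒m≤1+n ≤ℓ) (suffix-from q (vs! , es!) u∈)
  ...   | no u∉ with Any.any? (h ≟ᶠ_) (edges q)
  ...     | yes h∈ = relax (m≤n⇒m≤1+n ≤ℓ) (suffix-through q (vs! , es!) (¬Any⇒All¬ _ u∉) h∈ u∈h)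
  ...     | no h∉ =
    simplePath (s≤s ≤ℓ) (step h h∈E u∈h w∈h q) (¬Any⇒All¬ _ u∉ ∷ vs! , ¬Any⇒All¬ _ h∉ ∷ es!)

  closing-inL : ∀ {h} (p : Path G E u v ℓ) → v ∈ edge G h →
                ∀ i → lookup (vertices p) i ∈ edge G (lookup (edges p ∷ʳ h) i)
  closing-inL nil                v∈h zero    = v∈h
  closing-inL (step _ _ u∈g _ _) _   zero    = u∈g
  closing-inL (step _ _ _ _ p)   v∈h (suc i) = closing-inL p v∈h i

  closing-inR : ∀ {h} (p : Path G E u v ℓ) → y ∈ edge G h →
                ∀ i → lookup (targets p ∷ʳ y) i ∈ edge G (lookup (edges p ∷ʳ h) i)
  closing-inR nil                y∈h zero    = y∈h
  closing-inR (step _ _ _ w∈g _) _   zero    = w∈g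
  closing-inR (step _ _ _ _ p)   y∈h (suc i) = closing-inR p y∈h i

  -- The cycle follows p from y to x and returns to y through h.
  close-cycle : ∀ {h} (p : Path G E y x ℓ) → IsSimplePath p → All (_≢ h) (edges p) →
                x ∈ edge G h → y ∈ edge G h → Cycle G (suc ℓ)
  close-cycle {h = h} p (vs! , es!) es≢h x∈h y∈h = record
    { vs    = lookup (vertices p)
    ; hs    = lookup (edges p ∷ʳ h)
    ; vsInj = lookup-injective vs! _ _
    ; hsInj = lookup-injective (Unique-∷ʳ es! es≢h) _ _
    ; inL   = closing-inL p x∈h
    ; inR   = λ i → subst (_∈ edge G (lookup (edges p ∷ʳ h) i))
                          (sym (lookup-next (vertices p) i)) (closing-inR p y∈h i)
    }

  girth≤1+detour : ∀ {g h} → GirthAtLeast g G → h ∉ E → x ≢ y → x ∈ edge G h → y ∈ edge G h →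
                   Path G E y x ℓ → g ≤ suc ℓ
  girth≤1+detour {E = E} {h = h} girth h∉E x≢y x∈h y∈h p with simplify p
  ... | simplePath _ nil _ = ⊥-elim (x≢y refl)
  ... | simplePath ≤ℓ q@(step _ _ _ _ _) simple =
    ≤-trans (≮⇒≥ λ <g → girth _ (s≤s (s≤s z≤n)) <g (close-cycle q simple es≢h x∈h y∈h)) (s≤s ≤ℓ)
    where
    es≢h : All (_≢ h) (edges q)
    es≢h = All.map (λ e∈E e≡h → h∉E (subst (_∈ E) e≡h e∈E)) (edges-∈ q)

map-path : ∀ {n n′} {G : Hypergraph n} {H : Hypergraph n′} {E F u v}
           (φ : Fin n′ → Fin n) (ψ : Fin (m H) → Fin (m G)) →
           (∀ {x e} → x ∈ edge H e → φ x ∈ edge G (ψ e)) → (∀ {e} → e ∈ F → ψ e ∈ E) →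
           Path H F u v ℓ → Path G E (φ u) (φ v) ℓ
map-path φ ψ hom keep nil                    = nil
map-path φ ψ hom keep (step e e∈F u∈e w∈e p) =
  step (ψ e) (keep e∈F) (hom u∈e) (hom w∈e) (map-path φ ψ hom keep p)

-- Blowing up vertices into clones

lookup-concat-remQuot : (xss : Vec (Vec A b) n) (i : Fin (n * b)) →
                        lookup (concat xss) i ≡ lookup (lookup xss (quotient {n} b i)) (remainder {n} b i)
lookup-concat-remQuot {b = b} {n} xss i = begin
  lookup (concat xss) i             ≡⟨ cong (lookup (concat xss)) (combine-remQuot {n} b i) ⟨
  lookup (concat xss) (combine q ρ) ≡⟨ lookup-concat xss q ρ ⟩
  lookup (lookup xss q) ρ           ∎
  where
  open ≡-Reasoning
  q = quotient {n} b i
  ρ = remainder {n} b i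

∈-concat⁺ : ∀ (ps : Vec (Subset b) n) {i j} → j ∈ lookup ps i → combine i j ∈ concat ps
∈-concat⁺ ps {i} {j} j∈ =
  lookup⇒[]= (combine i j) (concat ps) (trans (lookup-concat ps i j) ([]=⇒lookup j∈))

∈-concat⁻ : ∀ (ps : Vec (Subset b) n) {v} → v ∈ concat ps →
            remainder {n} b v ∈ lookup ps (quotient {n} b v)
∈-concat⁻ {b = b} {n} ps {v} v∈ =
  lookup⇒[]= (remainder {n} b v) (lookup ps (quotient {n} b v))
             (trans (sym (lookup-concat-remQuot ps v)) ([]=⇒lookup v∈))

concat-injective : {xss yss : Vec (Vec A b) n} → concat xss ≡ concat yss → xss ≡ yss
concat-injective {xss = []}       {[]}       _  = refl
concat-injective {xss = xs ∷ xss} {ys ∷ yss} eq =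
  let xs≡ys , eq′ = ++-injective xs ys eq in cong₂ _∷_ xs≡ys (concat-injective eq′)

∣p++q∣ : (p : Subset k) (q : Subset n) → ∣ p ++ q ∣ ≡ ∣ p ∣ + ∣ q ∣
∣p++q∣ []            q = refl
∣p++q∣ (inside ∷ p)  q = cong suc (∣p++q∣ p q)
∣p++q∣ (outside ∷ p) q = ∣p++q∣ p q

⁅⁆-injective : Injective _≡_ _≡_ (⁅_⁆ {n})
⁅⁆-injective {x = x} {y} eq = x∈⁅y⁆⇒x≡y y (subst (x ∈_) eq (x∈⁅x⁆ x))

⊥≢⁅x⁆ : ∀ {x : Fin n} → ⊥ ≢ ⁅ x ⁆
⊥≢⁅x⁆ {x = x} eq = ∉⊥ (subst (x ∈_) (sym eq) (x∈⁅x⁆ x))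

lift : (p : Subset n) → Vec (Fin b) ∣ p ∣ → Vec (Subset b) n
lift []            []       = []
lift (outside ∷ p) ds       = ⊥ ∷ lift p ds
lift (inside ∷ p)  (d ∷ ds) = ⁅ d ⁆ ∷ lift p ds

∣concat-lift∣ : (p : Subset n) (ds : Vec (Fin b) ∣ p ∣) → ∣ concat (lift p ds) ∣ ≡ ∣ p ∣
∣concat-lift∣         []            []       = refl
∣concat-lift∣ {b = b} (outside ∷ p) ds       =
  trans (∣p++q∣ (⊥ {b}) _) (cong₂ _+_ (∣⊥∣≡0 b) (∣concat-lift∣ p ds))
∣concat-lift∣         (inside ∷ p)  (d ∷ ds) =
  trans (∣p++q∣ ⁅ d ⁆ _) (cong₂ _+_ (∣⁅x⁆∣≡1 d) (∣concat-lift∣ p ds))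

lift-injectiveˡ : ∀ (p q : Subset n) {ds : Vec (Fin b) ∣ p ∣} {es : Vec (Fin b) ∣ q ∣} →
                  lift p ds ≡ lift q es → p ≡ q
lift-injectiveˡ []            []                            _  = refl
lift-injectiveˡ (outside ∷ p) (outside ∷ q)                 eq =
  cong (outside ∷_) (lift-injectiveˡ p q (cong tail eq))
lift-injectiveˡ (inside ∷ p)  (inside ∷ q)  {_ ∷ _} {_ ∷ _} eq =
  cong (inside ∷_) (lift-injectiveˡ p q (cong tail eq))
lift-injectiveˡ (outside ∷ p) (inside ∷ q)  {es = _ ∷ _}    eq = contradiction (cong head eq) ⊥≢⁅x⁆
lift-injectiveˡ (inside ∷ p)  (outside ∷ q) {_ ∷ _}         eq = contradiction (sym (cong head eq)) ⊥≢⁅x⁆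

lift-injectiveʳ : ∀ (p : Subset n) {ds es : Vec (Fin b) ∣ p ∣} → lift p ds ≡ lift p es → ds ≡ es
lift-injectiveʳ []            {[]}     {[]}     _  = refl
lift-injectiveʳ (outside ∷ p)                   eq = lift-injectiveʳ p (cong tail eq)
lift-injectiveʳ (inside ∷ p)  {_ ∷ _}  {_ ∷ _}  eq =
  cong₂ _∷_ (⁅⁆-injective (cong head eq)) (lift-injectiveʳ p (cong tail eq))

lift-⊆ : ∀ (p : Subset n) (ds : Vec (Fin b) ∣ p ∣) x {j} → j ∈ lookup (lift p ds) x → x ∈ p
lift-⊆ (outside ∷ p) ds       zero    j∈ = contradiction j∈ ∉⊥
lift-⊆ (inside ∷ p)  (d ∷ ds) zero    _  = here
lift-⊆ (outside ∷ p) ds       (suc x) j∈ = there (lift-⊆ p ds x j∈)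
lift-⊆ (inside ∷ p)  (d ∷ ds) (suc x) j∈ = there (lift-⊆ p ds x j∈)

lift-⊇ : ∀ (p : Subset n) (ds : Vec (Fin b) ∣ p ∣) {x} → x ∈ p → ∃ λ j → j ∈ lookup (lift p ds) x
lift-⊇ (outside ∷ p) ds       (there x∈) = lift-⊇ p ds x∈
lift-⊇ (inside ∷ p)  (d ∷ ds) here       = d , x∈⁅x⁆ d
lift-⊇ (inside ∷ p)  (d ∷ ds) (there x∈) = lift-⊇ p ds x∈

inflate : Subset n → Subset (n * b)
inflate {b = b} p = concat (map (replicate b) p)

∣inflate∣ : (p : Subset n) → ∣ inflate {b = b} p ∣ ≡ ∣ p ∣ * b
∣inflate∣         []            = refl
∣inflate∣ {b = b} (inside ∷ p)  = trans (∣p++q∣ (⊤ {b}) _) (cong₂ _+_ (∣⊤∣≡n b) (∣inflate∣ p))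
∣inflate∣ {b = b} (outside ∷ p) = trans (∣p++q∣ (⊥ {b}) _) (cong₂ _+_ (∣⊥∣≡0 b) (∣inflate∣ p))

∈-inflate : ∀ (p : Subset n) {i} → quotient {n} b i ∈ p → i ∈ inflate {b = b} p
∈-inflate {n} {b} p {i} q∈p = lookup⇒[]= i (inflate p) (begin
  lookup (inflate p) i                      ≡⟨ lookup-concat-remQuot (map (replicate b) p) i ⟩
  lookup (lookup (map (replicate b) p) q) ρ ≡⟨ cong (λ s → lookup s ρ) (lookup-map q (replicate b) p) ⟩
  lookup (replicate b (lookup p q)) ρ       ≡⟨ lookup-replicate ρ (lookup p q) ⟩
  lookup p q                                ≡⟨ []=⇒lookup q∈p ⟩
  inside                                    ∎)
  where
  open ≡-Reasoning
  q = quotient {n} b i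
  ρ = remainder {n} b i

remQuot-injective : ∀ {n} k {i j : Fin (n * k)} → remQuot {n} k i ≡ remQuot k j → i ≡ j
remQuot-injective {n} k {i} {j} eq = begin
  i                                       ≡⟨ combine-remQuot {n} k i ⟨
  uncurry (combine {n} {k}) (remQuot k i) ≡⟨ cong (uncurry combine) eq ⟩
  uncurry (combine {n} {k}) (remQuot k j) ≡⟨ combine-remQuot {n} k j ⟩
  j                                       ∎
  where open ≡-Reasoning

digits : ∀ k → Fin (b ^ k) → Vec (Fin b) k
digits         zero    _ = []
digits {b = b} (suc k) τ = quotient (b ^ k) τ ∷ digits k (remainder {b} (b ^ k) τ)

digits-injective : ∀ k → Injective _≡_ _≡_ (digits {b} k)
digits-injective zero {zero} {zero} _ = refl
digits-injective {b} (suc k) eq =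
  let q≡q′ , ds≡ds′ = ∷-injective eq
  in remQuot-injective {b} (b ^ k) (cong₂ _,_ q≡q′ (digits-injective k ds≡ds′))

nonempty : (p : Subset n) → 1 ≤ ∣ p ∣ → ∃ λ x → x ∈ p
nonempty (inside ∷ p)  _     = zero , here
nonempty (outside ∷ p) 1≤∣p∣ = let x , x∈p = nonempty p 1≤∣p∣ in suc x , there x∈p

two-elements : (p : Subset n) → 2 ≤ ∣ p ∣ → ∃₂ λ x y → x ≢ y × x ∈ p × y ∈ p
two-elements (inside ∷ p)  (s≤s 1≤∣p∣) =
  let y , y∈p = nonempty p 1≤∣p∣ in zero , suc y , (λ ()) , here , there y∈p
two-elements (outside ∷ p) 2≤∣p∣ =
  let x , y , x≢y , x∈p , y∈p = two-elements p 2≤∣p∣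
  in suc x , suc y , x≢y ∘ suc-injective , there x∈p , there y∈p

-- Vertex combine x j is the j-th clone of x. Hyperedge combine h τ is the copy of h giving
-- the i-th vertex of h the clone numbered by the i-th digit of τ in base b.
module BlowUp {n} (G : Hypergraph n) (b r : ℕ) (uniform : Uniform r G) where

  labels : (h : Fin (m G)) → Fin (b ^ r) → Vec (Fin b) ∣ edge G h ∣
  labels h τ = subst (Vec (Fin b)) (sym (uniform h)) (digits r τ)

  copy : Fin (m G) → Fin (b ^ r) → Subset (n * b)
  copy h τ = concat (lift (edge G h) (labels h τ))

  blowUp : Hypergraph (n * b)
  blowUp = hypergraph (m G * b ^ r) λ e → copy (quotient (b ^ r) e) (remainder {m G} (b ^ r) e)

  base : Fin (n * b) → Fin n
  base = quotient b

  original : Fin (m blowUp) → Fin (m G)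
  original = quotient (b ^ r)

  copies : Fin (m G) → Subset (m blowUp)
  copies h = inflate ⁅ h ⁆

  blowUp-uniform : Uniform r blowUp
  blowUp-uniform e = trans (∣concat-lift∣ (edge G (original e)) _) (uniform (original e))

  copy-injective : Simple G → ∀ {h h′ τ τ′} → copy h τ ≡ copy h′ τ′ → h ≡ h′ × τ ≡ τ′
  copy-injective simple {h} eq with refl ← simple (lift-injectiveˡ (edge G h) _ (concat-injective eq)) =
    refl , digits-injective r (subst-injective (sym (uniform h))
                                 (lift-injectiveʳ (edge G h) (concat-injective eq)))

  blowUp-simple : Simple G → Simple blowUp
  blowUp-simple simple eq =
    let h≡h′ , τ≡τ′ = copy-injective simple eq in remQuot-injective (b ^ r) (cong₂ _,_ h≡h′ τ≡τ′)

  base-∈ : ∀ {v e} → v ∈ edge blowUp e → base v ∈ edge G (original e)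
  base-∈ {v} {e} v∈ =
    lift-⊆ (edge G (original e)) _ (base v) (∈-concat⁻ (lift (edge G (original e)) _) v∈)

  lift-∈ : ∀ e {x} → x ∈ edge G (original e) → ∃ λ v → v ∈ edge blowUp e × base v ≡ x
  lift-∈ e {x} x∈ =
    let j , j∈ = lift-⊇ (edge G (original e)) _ x∈
    in combine x j , ∈-concat⁺ (lift (edge G (original e)) _) j∈ , cong proj₁ (remQuot-combine x j)

  lifts-apart : 2 ≤ r → ∀ e → ∃₂ λ u v → u ∈ edge blowUp e × v ∈ edge blowUp e × base u ≢ base v
  lifts-apart 2≤r e =
    let x , y , x≢y , x∈ , y∈ =
          two-elements (edge G (original e)) (subst (2 ≤_) (sym (uniform (original e))) 2≤r)
        u , u∈ , u↦x = lift-∈ e x∈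
        v , v∈ , v↦y = lift-∈ e y∈
    in u , v , u∈ , v∈ , λ eq → x≢y (trans (sym u↦x) (trans eq v↦y))

  spanners-complete : ∀ {f t g} → GirthAtLeast g G → 2 ≤ r → b ^ r ≤ f → suc (suc t) ≤ g →
                      ∀ S → FTSpanner f t blowUp S → ∀ e → e ∈ S
  spanners-complete {f} {t} {g} girth 2≤r bʳ≤f t+2≤g S spanner e with e ∈? S
  ... | yes e∈S = e∈S
  ... | no e∉S =
    let u , v , u∈e , v∈e , apart = lifts-apart 2≤r e
        ℓ , ℓ≤t·1 , p = spanner F ∣F∣≤f v u 1 (step e e∉F v∈e u∈e nil)
        g≤1+ℓ = girth≤1+detour girth h∉∁⁅h⁆ apart (base-∈ u∈e) (base-∈ v∈e)
                               (map-path base original base-∈ avoids-h p)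
        ℓ≤t = ≤-trans ℓ≤t·1 (≤-reflexive (*-identityʳ t))
    in ⊥-elim (<-irrefl refl (≤-trans t+2≤g (≤-trans g≤1+ℓ (s≤s ℓ≤t))))
    where
    h = original e
    F = copies h ∩ S
    ∣F∣≤f : ∣ F ∣ ≤ f
    ∣F∣≤f = begin
      ∣ F ∣             ≤⟨ p⊆q⇒∣p∣≤∣q∣ (p∩q⊆p (copies h) S) ⟩
      ∣ copies h ∣      ≡⟨ ∣inflate∣ ⁅ h ⁆ ⟩
      ∣ ⁅ h ⁆ ∣ * b ^ r ≡⟨ cong (_* b ^ r) (∣⁅x⁆∣≡1 h) ⟩
      1 * b ^ r         ≡⟨ *-identityˡ (b ^ r) ⟩
      b ^ r             ≤⟨ bʳ≤f ⟩
      f                 ∎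
      where open ≤-Reasoning
    e∉F : e ∈ ∁ F
    e∉F = x∉p⇒x∈∁p (e∉S ∘ proj₂ ∘ x∈p∩q⁻ (copies h) S)
    avoids-h : ∀ {e′} → e′ ∈ S ∩ ∁ F → original e′ ∈ ∁ ⁅ h ⁆
    avoids-h e′∈ =
      let e′∈S , e′∉F = x∈p∩q⁻ S (∁ F) e′∈
      in x∉p⇒x∈∁p λ h′∈⁅h⁆ → x∈∁p⇒x∉p e′∉F (x∈p∩q⁺ (∈-inflate ⁅ h ⁆ h′∈⁅h⁆ , e′∈S))
    h∉∁⁅h⁆ : h ∉ ∁ ⁅ h ⁆
    h∉∁⁅h⁆ h∈ = x∈∁p⇒x∉p h∈ (x∈⁅x⁆ h)

-- Arithmetic

^-distrib-* : ∀ m n o → (m * n) ^ o ≡ m ^ o * n ^ o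
^-distrib-* m n zero    = refl
^-distrib-* m n (suc o) = trans (cong (m * n *_) (^-distrib-* m n o)) (interchange m n (m ^ o) (n ^ o))

floor-root : ∀ r .{{_ : NonZero r}} f → 1 ≤ f → ∃ λ b → 1 ≤ b × b ^ r ≤ f × f < suc b ^ r
floor-root r (suc zero) _ = 1 , ≤-refl , ≤-reflexive (^-zeroˡ r) , ^-monoʳ-≤ 2 (>-nonZero⁻¹ r)
floor-root r (suc (suc f)) _ with floor-root r (suc f) (s≤s z≤n)
... | b , 1≤b , bʳ≤1+f , 1+f<[1+b]ʳ with suc b ^ r ≤? suc (suc f)
...   | yes [1+b]ʳ≤2+f = suc b , s≤s z≤n , [1+b]ʳ≤2+f , ≤-<-trans 1+f<[1+b]ʳ (^-monoˡ-< r ≤-refl)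
...   | no [1+b]ʳ≰2+f  = b , 1≤b , m≤n⇒m≤1+n bʳ≤1+f , ≰⇒> [1+b]ʳ≰2+f

exponents≤ : ∀ {k r} q → 1 ≤ k → 2 ≤ r → (r * k ∸ k ∸ 1) * q + (q * k + q ∸ k) ≤ r * k * q
exponents≤ {k} {r} q 1≤k 2≤r = begin
  α * q + (q * k + q ∸ k) ≤⟨ +-monoʳ-≤ (α * q) (m∸n≤m (q * k + q) k) ⟩
  α * q + (q * k + q)     ≡⟨ cong (α * q +_) (trans (+-comm (q * k) q) (cong (q +_) (*-comm q k))) ⟩
  α * q + suc k * q       ≡⟨ *-distribʳ-+ q α (suc k) ⟨
  (α + suc k) * q         ≡⟨ cong (_* q) α+1+k≡rk ⟩
  r * k * q               ∎
  where
  open ≤-Reasoning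
  α = r * k ∸ k ∸ 1
  k+1≤rk : k + 1 ≤ r * k
  k+1≤rk = begin
    k + 1       ≤⟨ +-monoʳ-≤ k 1≤k ⟩
    k + k       ≡⟨ cong (k +_) (+-identityʳ k) ⟨
    2 * k       ≤⟨ *-monoˡ-≤ k 2≤r ⟩
    r * k       ∎
  α+1+k≡rk : α + suc k ≡ r * k
  α+1+k≡rk = trans (cong₂ _+_ (∸-+-assoc (r * k) k 1) (+-comm 1 k)) (m∸n+n≡m k+1≤rk)

growth : ∀ {f c b i M a x y r K} .{{_ : NonZero c}} → f ≤ c ^ r → b ≤ c → i ^ x ≤ M ^ y →
         a + x ≤ K → y * r ≡ K → f ^ a * (i * b) ^ (x * r) ≤ (c ^ r * M) ^ K
growth {f} {c} {b} {i} {M} {a} {x} {y} {r} {K} f≤cʳ b≤c iˣ≤Mʸ a+x≤K yr≡K = begin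
  f ^ a * (i * b) ^ (x * r)                   ≤⟨ *-monoˡ-≤ _ (^-monoˡ-≤ a f≤cʳ) ⟩
  (c ^ r) ^ a * (i * b) ^ (x * r)             ≡⟨ cong₂ _*_ (^-*-assoc c r a) (^-distrib-* i b (x * r)) ⟩
  c ^ (r * a) * (i ^ (x * r) * b ^ (x * r))   ≤⟨ *-monoʳ-≤ (c ^ (r * a)) (*-mono-≤ iˣʳ≤Mᴷ bˣʳ≤cˣʳ) ⟩
  c ^ (r * a) * (M ^ K * c ^ (x * r))         ≡⟨ cong (c ^ (r * a) *_) (*-comm (M ^ K) (c ^ (x * r))) ⟩
  c ^ (r * a) * (c ^ (x * r) * M ^ K)         ≡⟨ *-assoc (c ^ (r * a)) (c ^ (x * r)) (M ^ K) ⟨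
  c ^ (r * a) * c ^ (x * r) * M ^ K           ≡⟨ cong (_* M ^ K) (^-distribˡ-+-* c (r * a) (x * r)) ⟨
  c ^ (r * a + x * r) * M ^ K                 ≤⟨ *-monoˡ-≤ (M ^ K) (^-monoʳ-≤ c exponent≤) ⟩
  c ^ (r * K) * M ^ K                         ≡⟨ cong (_* M ^ K) (^-*-assoc c r K) ⟨
  (c ^ r) ^ K * M ^ K                         ≡⟨ ^-distrib-* (c ^ r) M K ⟨
  (c ^ r * M) ^ K                             ∎
  where
  open ≤-Reasoning
  iˣʳ≤Mᴷ : i ^ (x * r) ≤ M ^ K
  iˣʳ≤Mᴷ = begin
    i ^ (x * r)   ≡⟨ ^-*-assoc i x r ⟨
    (i ^ x) ^ r   ≤⟨ ^-monoˡ-≤ r iˣ≤Mʸ ⟩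
    (M ^ y) ^ r   ≡⟨ ^-*-assoc M y r ⟩
    M ^ (y * r)   ≡⟨ cong (M ^_) yr≡K ⟩
    M ^ K         ∎
  bˣʳ≤cˣʳ : b ^ (x * r) ≤ c ^ (x * r)
  bˣʳ≤cˣʳ = ^-monoˡ-≤ (x * r) b≤c
  exponent≤ : r * a + x * r ≤ r * K
  exponent≤ = begin
    r * a + x * r ≡⟨ cong (r * a +_) (*-comm x r) ⟩
    r * a + r * x ≡⟨ *-distribˡ-+ r a x ⟨
    r * (a + x)   ≤⟨ *-monoʳ-≤ r a+x≤K ⟩
    r * K         ∎

blowUp-density : ∀ {k r q f b i M} → 1 ≤ k → 2 ≤ r → 1 ≤ b → f ≤ (2 * b) ^ r →
                 i ^ (q * k + q ∸ k) ≤ M ^ (q * k) →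
                 f ^ ((r * k ∸ k ∸ 1) * q) * (i * b) ^ ((q * k + q ∸ k) * r)
                   ≤ (2 ^ r * (M * b ^ r)) ^ (r * k * q)
blowUp-density {k} {r} {q} {f} {b} {i} {M} 1≤k 2≤r 1≤b f≤[2b]ʳ iˣ≤Mʸ = begin
  f ^ ((r * k ∸ k ∸ 1) * q) * (i * b) ^ ((q * k + q ∸ k) * r)
    ≤⟨ growth {a = (r * k ∸ k ∸ 1) * q} {y = q * k} {{>-nonZero (≤-trans 1≤b (m≤n*m b 2))}}
              f≤[2b]ʳ (m≤n*m b 2) iˣ≤Mʸ (exponents≤ q 1≤k 2≤r) qk·r≡rk·q ⟩
  ((2 * b) ^ r * M) ^ (r * k * q)
    ≡⟨ cong (_^ (r * k * q)) (begin-equality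
      (2 * b) ^ r * M     ≡⟨ cong (_* M) (^-distrib-* 2 b r) ⟩
      2 ^ r * b ^ r * M   ≡⟨ *-assoc (2 ^ r) (b ^ r) M ⟩
      2 ^ r * (b ^ r * M) ≡⟨ cong (2 ^ r *_) (*-comm (b ^ r) M) ⟩
      2 ^ r * (M * b ^ r) ∎) ⟩
  (2 ^ r * (M * b ^ r)) ^ (r * k * q) ∎
  where
  open ≤-Reasoning
  qk·r≡rk·q : q * k * r ≡ r * k * q
  qk·r≡rk·q = trans (*-comm (q * k) r) (trans (cong (r *_) (*-comm q k)) (sym (*-assoc r k q)))

-- The lower-bound family

⌊1+2k/2⌋≡k : ∀ k → ⌊ suc (2 * k) /2⌋ ≡ k
⌊1+2k/2⌋≡k zero    = refl
⌊1+2k/2⌋≡k (suc k) = cong suc (trans (cong ⌊_/2⌋ (+-suc k (k + 0))) (⌊1+2k/2⌋≡k k))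

blowUp-family : SVConjecture → ∀ {k r f b} → 1 ≤ k → 2 ≤ r → 1 ≤ b → b ^ r ≤ f → f ≤ (2 * b) ^ r →
                LowerBoundFamily k f r (2 ^ r)
blowUp-family sv {k} {r} {f} {b} 1≤k 2≤r 1≤b bʳ≤f f≤[2b]ʳ = (_* b) , Hs , unbounded , properties , density
  where
  instance
    b≢0 : NonZero b
    b≢0 = >-nonZero 1≤b
  -- With l = 2k + 1, ⌊ l /2⌋ = k and a detour of length ≤ 2k − 1 closes a cycle shorter than l + 1.
  l = suc (2 * k)
  Hs : (i : ℕ) → Hypergraph (i * b)
  Hs i = let _ , (G , _ , uniform , _) , _ = maxEdges-exists i r l in BlowUp.blowUp G b r uniform
  unbounded : ∀ N → ∃ λ i → N ≤ i * b
  unbounded N = N , m≤m*n N b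
  properties : ∀ i → Simple (Hs i) × Uniform r (Hs i) ×
                     (∀ S → FTSpanner f (2 * k ∸ 1) (Hs i) S → ∀ e → e ∈ S)
  properties i =
    let _ , (G , simple , uniform , girth , _) , _ = maxEdges-exists i r l
        open BlowUp G b r uniform
    in blowUp-simple simple , blowUp-uniform ,
       spanners-complete girth 2≤r bʳ≤f (s≤s (s≤s (m∸n≤m (2 * k) 1)))
  density : ∀ q → 1 ≤ q → ∃ λ N → ∀ i → N ≤ i * b →
            f ^ ((r * k ∸ k ∸ 1) * q) * (i * b) ^ ((q * k + q ∸ k) * r)
              ≤ (2 ^ r * m (Hs i)) ^ (r * k * q)
  density q 1≤q =
    let N , large⇒dense = sv l r (s≤s (*-monoʳ-≤ 2 1≤k)) 2≤r q 1≤q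
    in N * b , λ i Nb≤ib →
      let M , isMax = maxEdges-exists i r l
          (_ , _ , _ , _ , mG≡M) , _ = isMax
          iˣ≤Mʸ , _ = large⇒dense i (*-cancelʳ-≤ N i b Nb≤ib) M isMax
      in ≤-trans (blowUp-density 1≤k 2≤r 1≤b f≤[2b]ʳ
                    (subst (λ k′ → i ^ (q * k′ + q ∸ k′) ≤ M ^ (q * k′)) (⌊1+2k/2⌋≡k k) iˣ≤Mʸ))
                 (≤-reflexive (cong (λ M → (2 ^ r * (M * b ^ r)) ^ (r * k * q)) (sym mG≡M)))

theorem2 : SVConjecture →
    ∀ k r → 1 ≤ k → 2 ≤ r →
    ∃ λ C → 1 ≤ C × (∀ f → 1 ≤ f → LowerBoundFamily k f r C)
theorem2 sv k r 1≤k 2≤r = 2 ^ r , m^n>0 2 r , λ f 1≤f →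
  let b , 1≤b , bʳ≤f , f<[1+b]ʳ = floor-root r {{>-nonZero (≤-trans (s≤s z≤n) 2≤r)}} f 1≤f
      1+b≤2b = ≤-trans (+-monoˡ-≤ b 1≤b) (≤-reflexive (cong (b +_) (sym (+-identityʳ b))))
  in blowUp-family sv 1≤k 2≤r 1≤b bʳ≤f (≤-trans (<⇒≤ f<[1+b]ʳ) (^-monoˡ-≤ r 1+b≤2b))
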